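{- Let $M$ be a maximal path-like map such that $\mathbf{P}_{VEF}(M)$ has a realizer $\{L_1,L_2,L_3\}$, fix an angle coloring induced by this realizer and the resulting oriented coloring of the chordal edges. If $c$ is the color of a chordal edge $e$, then $e > F_\infty$ in $L_c$, where $F_\infty$ is the outer face.
   Context: A planar map consists of a finite planar multigraph with a plane drawing; $\mathbf{P}_{VEF}(M)$ is the poset on vertices, edges and faces ordered by incidence/inclusion. A realizer of a poset is a family of linear extensions whose intersection is the poset; a pair $(a,b)$ is reversed in $L$ if $b<a$ in $L$. A simple 2-connected outerplanar map has a unique Hamilton cycle; its edges are cycle edges, the rest chordal edges. $M$ is path-like if its interior dual is a simple path (then the Hamilton cycle bounds the outer face $F_\infty$), and maximal path-like if in addition every bounded face is a triangle. An inner angle is a pair $(u,T)$, $T$ an interior triangle with vertices $u,v,w$; its critical pair is $(u,vw)$ if $vw$ is a cycle edge and $(u,F)$, $F$ the other interior face containing $vw$, if $vw$ is chordal. An angle coloring induced by the realizer assigns to each inner angle a color $i\in\{1,2,3\}$ such that its critical pair is reversed in $L_i$. For a chordal edge $\{a,b\}$ lying in triangles $T_\ell,T_r$, among the four angles of $T_\ell,T_r$ at $a$ and at $b$ exactly one color occurs twice, namely as the two angles at a single endpoint; the oriented coloring gives the chordal edge this color and orients it towards that endpoint. -}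

module Defs where

open import Data.Nat using (ℕ; zero; suc; _<_; _≤_)
open import Data.Fin using (Fin; toℕ)
open import Data.List using (List; []; _∷_; length; lookup)
open import Data.List.Membership.Propositional using (_∈_)
open import Data.List.Relation.Unary.All using (All)
open import Data.List.Relation.Unary.Linked using (Linked)
open import Data.List.Relation.Unary.Unique.Propositional using (Unique)
open import Data.Product using (Σ; ∃; _×_; _,_)
open import Data.Sum using (_⊎_)
open import Data.Unit using (⊤)
open import Data.Empty using (⊥)
open import Relation.Nullary using (¬_)
open import Relation.Binary.PropositionalEquality using (_≡_; _≢_)

-- Encoding of a simple 2-connected outerplanar map on n ≥ 3 vertices.
-- Vertices are Fin n, numbered 0,…,n-1 along the Hamilton cycle, which
-- bounds the outer face F∞.  The map is given by its list of chords
-- (pairs (i , j) with i < j).  An edge is always written with its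
-- endpoints in increasing order.

CycleEdge : {n : ℕ} → Fin n → Fin n → Set
CycleEdge {n} i j = (toℕ j ≡ suc (toℕ i)) ⊎ ((toℕ i ≡ 0) × (suc (toℕ j) ≡ n))

module _ {n : ℕ} (chords : List (Fin n × Fin n)) where

  Edge : Fin n → Fin n → Set
  Edge i j = (toℕ i < toℕ j) × (CycleEdge i j ⊎ ((i , j) ∈ chords))

  Chordal : Fin n → Fin n → Set
  Chordal i j = (i , j) ∈ chords

  Adj : Fin n → Fin n → Set
  Adj x y = Edge x y ⊎ Edge y x

  record IsOuterplanar : Set where
    field
      three≤n      : 3 ≤ n
      chord-edge   : All (λ { (i , j) → (toℕ i < toℕ j) × ¬ CycleEdge i j }) chords
      chord-simple : Unique chords
      noncrossing  : ∀ a b c d → (a , b) ∈ chords → (c , d) ∈ chords →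
                     ¬ ((toℕ a < toℕ c) × (toℕ c < toℕ b) × (toℕ b < toℕ d))

  -- A bounded face, given by its vertices in increasing order s₁ < … < s_k
  -- (k ≥ 3): cyclically consecutive vertices are adjacent (these are the
  -- boundary edges) and non-consecutive ones are not (no chord inside).
  CyclicConsec : (k : ℕ) → Fin k → Fin k → Set
  CyclicConsec k p q = (suc (toℕ p) ≡ toℕ q) ⊎ ((toℕ p ≡ 0) × (suc (toℕ q) ≡ k))

  IsBoundedFace : List (Fin n) → Set
  IsBoundedFace S =
    Linked (λ x y → toℕ x < toℕ y) S × (3 ≤ length S) ×
    (∀ (p q : Fin (length S)) → toℕ p < toℕ q →
       (Adj (lookup S p) (lookup S q) → CyclicConsec (length S) p q) ×
       (CyclicConsec (length S) p q → Adj (lookup S p) (lookup S q)))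

  AllTriangles : Set
  AllTriangles = ∀ S → IsBoundedFace S → length S ≡ 3

  DualAdj : List (Fin n) → List (Fin n) → Set
  DualAdj S T = (S ≢ T) × Σ (Fin n) λ i → Σ (Fin n) λ j →
                Edge i j × i ∈ S × j ∈ S × i ∈ T × j ∈ T

  DualIsPath : Set
  DualIsPath = Σ (List (List (Fin n))) λ Fs →
    All IsBoundedFace Fs × (∀ S → IsBoundedFace S → S ∈ Fs) × Unique Fs ×
    (∀ (p q : Fin (length Fs)) →
       (DualAdj (lookup Fs p) (lookup Fs q) → (suc (toℕ p) ≡ toℕ q ⊎ suc (toℕ q) ≡ toℕ p)) ×
       ((suc (toℕ p) ≡ toℕ q ⊎ suc (toℕ q) ≡ toℕ p) → DualAdj (lookup Fs p) (lookup Fs q)))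

  record IsMaximalPathLike : Set where
    field
      outerplanar : IsOuterplanar
      maximal     : AllTriangles
      pathLike    : DualIsPath

-- The poset P_VEF(M).  Raw elements; only the valid ones belong to P.

data Elem (n : ℕ) : Set where
  vtx   : Fin n → Elem n
  edg   : Fin n → Fin n → Elem n
  fac   : List (Fin n) → Elem n
  outer : Elem n

module _ {n : ℕ} (chords : List (Fin n × Fin n)) where

  Valid : Elem n → Set
  Valid (vtx _)   = ⊤
  Valid (edg i j) = Edge chords i j
  Valid (fac S)   = IsBoundedFace chords S
  Valid outer     = ⊤

  _<P_ : Elem n → Elem n → Set
  vtx u   <P edg i j = Edge chords i j × (u ≡ i ⊎ u ≡ j)
  vtx u   <P fac S   = IsBoundedFace chords S × u ∈ S
  vtx u   <P outer   = ⊤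
  edg i j <P fac S   = Edge chords i j × IsBoundedFace chords S × i ∈ S × j ∈ S
  edg i j <P outer   = Edge chords i j × CycleEdge i j
  _       <P _       = ⊥

  _≤P_ : Elem n → Elem n → Set
  x ≤P y = (x ≡ y) ⊎ (x <P y)

  -- L x y means "x < y in L"; a linear extension of P_VEF(M)
  record IsLinearExtension (L : Elem n → Elem n → Set) : Set where
    field
      irrefl  : ∀ x → ¬ L x x
      trans   : ∀ x y z → L x y → L y z → L x z
      total   : ∀ x y → Valid x → Valid y → x ≢ y → L x y ⊎ L y x
      extends : ∀ x y → x <P y → L x y

  record IsRealizer (L : Fin 3 → Elem n → Elem n → Set) : Set where
    field
      linext  : ∀ i → IsLinearExtension (L i)
      realize : ∀ x y → Valid x → Valid y → ¬ (x ≤P y) → ∃ λ i → L i y x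

  -- The critical pair of the inner angle (u , T), where v < w are the other
  -- two vertices of T, is reversed in the order L:
  --   if vw is a cycle edge: vw < u in L;
  --   if vw is chordal: F < u in L for the other bounded face F ∋ v , w.
  CritReversed : (Elem n → Elem n → Set) → Fin n → List (Fin n) → Fin n → Fin n → Set
  CritReversed L u T v w =
    (CycleEdge v w → L (edg v w) (vtx u)) ×
    (Chordal chords v w → ∀ F → IsBoundedFace chords F → F ≢ T → v ∈ F → w ∈ F → L (fac F) (vtx u))

  IsAngleColoring : (Fin 3 → Elem n → Elem n → Set) → (Fin n → List (Fin n) → Fin 3) → Set
  IsAngleColoring L col = ∀ a b c → let T = a ∷ b ∷ c ∷ [] in IsBoundedFace chords T →
    CritReversed (L (col a T)) a T b c ×
    CritReversed (L (col b T)) b T a c ×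
    CritReversed (L (col c T)) c T a b

-- Let x and y be the apices of the triangles Tl and Tr on the chord ab, and i, j the colours of
-- their angles.  As ab is chordal, the critical pair of the angle at x is (x, Tr), so ab < Tr < x
-- in L_i: no order in which x lies below ab can be L_i, and likewise for y and L_j.  This rules
-- out i = j (x < Tl < y < Tr < x in L_i), the colour k with F∞ < ab given by the realizer (since
-- x < F∞), and the doubled colour c at an endpoint u of ab (an angle lies above the rest of its
-- triangle in its own colour, so x < u < ab in L_c).  Three colours then force k = c.
-- The geometric input is that a chord lies on a bounded face avoiding any given third vertex, so
-- a reversed critical pair (u, F) still puts the other vertices of u's triangle below u.

module Submission where

open import Defs
open import Data.Nat using (ℕ; suc; _<_; _≤_; _∸_; z≤n; s≤s; z<s; s<s)
open import Data.Nat.Properties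
open import Data.Fin using (Fin; toℕ; fromℕ<) renaming (zero to fzero; suc to fsuc)
open import Data.Fin.Properties using (toℕ-injective; toℕ-fromℕ<; toℕ<n; punchOut-injective)
  renaming (_≟_ to _≟ᶠ_; <⇒≢ to <⇒≢ᶠ)
open import Data.List using (List; []; _∷_; length; lookup; filter; allFin)
open import Data.List.Membership.Propositional using (_∈_; _∉_; find; lose)
open import Data.List.Membership.Propositional.Properties using (∈-lookup; ∈-filter⁺; ∈-filter⁻; ∈-allFin)
open import Data.List.Relation.Unary.Any using (Any; here; there; index; any?)
open import Data.List.Relation.Unary.Any.Properties using (lookup-index)
import Data.List.Relation.Unary.All as All
open import Data.List.Relation.Unary.Linked as Linked using (Linked; [-]; _∷_)
open import Data.List.Relation.Unary.Linked.Properties using (AllPairs⇒Linked; filter⁺)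
open import Data.List.Relation.Unary.AllPairs.Properties using (tabulate⁺-<)
open import Data.Maybe.Relation.Binary.Connected using (just)
open import Data.List.Extrema.Nat using (argmax; argmin; argmax-all; argmin-all; f[xs]≤f[argmax]; f[argmin]≤f[xs])
open import Data.Product using (Σ; _×_; _,_; proj₁; proj₂; uncurry)
open import Data.Product.Properties using (≡-dec)
open import Data.Sum using (_⊎_; inj₁; inj₂; [_,_]; [_,_]′)
open import Data.Empty using (⊥; ⊥-elim)
open import Data.Unit using (tt)
open import Function using (_∘_; id)
open import Relation.Nullary using (¬_; yes; no)
open import Relation.Nullary.Decidable using (_×-dec_; ¬?)
open import Relation.Unary using (Decidable)
open import Level using (0ℓ)
open import Relation.Binary.Bundles using (StrictPartialOrder)
open import Relation.Binary.PropositionalEquality.Properties using (isEquivalence)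
open import Relation.Binary.Definitions using (DecidableEquality; tri<; tri≈; tri>)
open import Relation.Binary.PropositionalEquality using (_≡_; _≢_; refl; sym; trans; cong; subst; subst₂)

≢-unique-Fin2 : {x y z : Fin 2} → x ≢ z → y ≢ z → x ≡ y
≢-unique-Fin2 {fzero}      {fzero}      _   _   = refl
≢-unique-Fin2 {fsuc fzero} {fsuc fzero} _   _   = refl
≢-unique-Fin2 {fzero}      {fsuc fzero} {fzero}      x≢z _   = ⊥-elim (x≢z refl)
≢-unique-Fin2 {fzero}      {fsuc fzero} {fsuc fzero} _   y≢z = ⊥-elim (y≢z refl)
≢-unique-Fin2 {fsuc fzero} {fzero}      {fzero}      _   y≢z = ⊥-elim (y≢z refl)
≢-unique-Fin2 {fsuc fzero} {fzero}      {fsuc fzero} x≢z _   = ⊥-elim (x≢z refl)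

-- Removing i from Fin 3 leaves a copy of Fin 2 in which k and c both avoid the image of j.
≢-unique-Fin3 : {i j k c : Fin 3} → i ≢ j → k ≢ i → k ≢ j → c ≢ i → c ≢ j → k ≡ c
≢-unique-Fin3 i≢j k≢i k≢j c≢i c≢j =
  punchOut-injective i≢k i≢c (≢-unique-Fin2 (k≢j ∘ punchOut-injective i≢k i≢j) (c≢j ∘ punchOut-injective i≢c i≢j))
  where
  i≢k = k≢i ∘ sym
  i≢c = c≢i ∘ sym

module _ {A : Set} {P : A → Set} (P? : Decidable P) (f : A → ℕ) {x₀ : A} (P₀ : P x₀) (xs : List A) where

  private
    Candidate : A → Set
    Candidate x = P x × (x ≡ x₀ ⊎ x ∈ xs)

    candidates : All.All Candidate (filter P? xs)
    candidates = All.tabulate λ x∈ → let x∈xs , Px = ∈-filter⁻ P? {xs = xs} x∈ in Px , inj₂ x∈xs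

  maximal-witness : Σ A λ x → (P x × (x ≡ x₀ ⊎ x ∈ xs)) × (∀ {y} → y ∈ xs → P y → f y ≤ f x)
  maximal-witness = x , argmax-all f (P₀ , inj₁ refl) candidates ,
                    λ y∈ Py → All.lookup (f[xs]≤f[argmax] x₀ (filter P? xs)) (∈-filter⁺ P? y∈ Py)
    where x = argmax f x₀ (filter P? xs)

  minimal-witness : Σ A λ x → (P x × (x ≡ x₀ ⊎ x ∈ xs)) × (∀ {y} → y ∈ xs → P y → f x ≤ f y)
  minimal-witness = x , argmin-all f (P₀ , inj₁ refl) candidates ,
                    λ y∈ Py → All.lookup (f[argmin]≤f[xs] x₀ (filter P? xs)) (∈-filter⁺ P? y∈ Py)
    where x = argmin f x₀ (filter P? xs)

module StrictlySorted {A : Set} (key : A → ℕ) where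

  _≺_ : A → A → Set
  x ≺ y = key x < key y

  lookup-< : ∀ {S} → Linked _≺_ S → {p q : Fin (length S)} → toℕ p < toℕ q → lookup S p ≺ lookup S q
  lookup-< (r ∷ l) {fzero}  {fsuc q} _         = Linked.lookup <-trans l (just r) q
  lookup-< (r ∷ l) {fsuc p} {fsuc q} (s≤s p<q) = lookup-< l p<q

  lookup-≤ : ∀ {S} → Linked _≺_ S → {p q : Fin (length S)} → toℕ p ≤ toℕ q → key (lookup S p) ≤ key (lookup S q)
  lookup-≤ {S} sorted p≤q with m≤n⇒m<n∨m≡n p≤q
  ... | inj₁ p<q = <⇒≤ (lookup-< sorted p<q)
  ... | inj₂ p≡q = ≤-reflexive (cong (key ∘ lookup S) (toℕ-injective p≡q))

  lookup-reflects-< : ∀ {S} → Linked _≺_ S → {p q : Fin (length S)} → lookup S p ≺ lookup S q → toℕ p < toℕ q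
  lookup-reflects-< sorted p≺q = ≰⇒> (λ q≤p → <⇒≱ p≺q (lookup-≤ sorted q≤p))

  index-reflects-< : ∀ {S s t} → Linked _≺_ S → (s∈ : s ∈ S) (t∈ : t ∈ S) → s ≺ t →
                     toℕ (index s∈) < toℕ (index t∈)
  index-reflects-< sorted s∈ t∈ s≺t = lookup-reflects-< sorted (subst₂ _≺_ (lookup-index s∈) (lookup-index t∈) s≺t)

  least-index : ∀ {S} → Linked _≺_ S → (p : Fin (length S)) →
                (∀ q → key (lookup S p) ≤ key (lookup S q)) → toℕ p ≡ 0
  least-index {_ ∷ _} sorted fzero    _     = refl
  least-index {_ ∷ _} sorted (fsuc p) least = ⊥-elim (<⇒≱ (lookup-< sorted {fzero} {fsuc p} z<s) (least fzero))

  greatest-index : ∀ {S} → Linked _≺_ S → (p : Fin (length S)) →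
                   (∀ q → key (lookup S q) ≤ key (lookup S p)) → suc (toℕ p) ≡ length S
  greatest-index {_ ∷ []}    sorted fzero    _        = refl
  greatest-index {_ ∷ _ ∷ _} sorted fzero    greatest =
    ⊥-elim (<⇒≱ (lookup-< sorted {fzero} {fsuc fzero} z<s) (greatest (fsuc fzero)))
  greatest-index {_ ∷ _}     sorted (fsuc p) greatest =
    cong suc (greatest-index (Linked.tail sorted) p (greatest ∘ fsuc))

  3≤length : ∀ {S x y z} → Linked _≺_ S → x ∈ S → y ∈ S → z ∈ S → x ≺ y → y ≺ z → 3 ≤ length S
  3≤length sorted x∈ y∈ z∈ x≺y y≺z =
    ≤-trans (s≤s (≤-trans (s≤s (≤-trans z<s (index-reflects-< sorted x∈ y∈ x≺y)))
                          (index-reflects-< sorted y∈ z∈ y≺z)))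
            (toℕ<n (index z∈))

module FaceCriterion {n : ℕ} (chords : List (Fin n × Fin n)) where
  open StrictlySorted (toℕ {n})

  NoneBetween : List (Fin n) → Fin n → Fin n → Set
  NoneBetween S s t = ∀ {m} → m ∈ S → s ≺ m → m ≺ t → ⊥

  Least Greatest : List (Fin n) → Fin n → Set
  Least    S s = ∀ {m} → m ∈ S → toℕ s ≤ toℕ m
  Greatest S t = ∀ {m} → m ∈ S → toℕ m ≤ toℕ t

  isBoundedFace-intro : ∀ S → Linked _≺_ S → 3 ≤ length S →
    (∀ {s t} → s ∈ S → t ∈ S → s ≺ t → NoneBetween S s t → Adj chords s t) →
    (∀ {s t} → s ∈ S → t ∈ S → Least S s → Greatest S t → Adj chords s t) →
    (∀ {s m t} → s ∈ S → m ∈ S → t ∈ S → s ≺ m → m ≺ t → Adj chords s t → Least S s × Greatest S t) →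
    IsBoundedFace chords S
  isBoundedFace-intro S sorted 3≤len neighbours ends onlyEnds =
    sorted , 3≤len , λ p q p<q → adj⇒consec p q p<q , consec⇒adj p q p<q
    where
    adj⇒consec : ∀ p q → toℕ p < toℕ q → Adj chords (lookup S p) (lookup S q) → CyclicConsec chords (length S) p q
    adj⇒consec p q p<q adj with suc (toℕ p) ≟ toℕ q
    ... | yes p+1≡q = inj₁ p+1≡q
    ... | no  p+1≢q = inj₂ (least-index sorted p (least ∘ ∈-lookup) , greatest-index sorted q (greatest ∘ ∈-lookup))
      where
      p+1<q = ≤∧≢⇒< p<q p+1≢q
      r : Fin (length S)
      r = fromℕ< (<-trans p+1<q (toℕ<n q))
      p<r : toℕ p < toℕ r
      p<r = subst (toℕ p <_) (sym (toℕ-fromℕ< _)) ≤-refl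
      r<q : toℕ r < toℕ q
      r<q = subst (_< toℕ q) (sym (toℕ-fromℕ< _)) p+1<q
      least×greatest = onlyEnds (∈-lookup p) (∈-lookup r) (∈-lookup q) (lookup-< sorted p<r) (lookup-< sorted r<q) adj
      least = proj₁ least×greatest
      greatest = proj₂ least×greatest
    consec⇒adj : ∀ p q → toℕ p < toℕ q → CyclicConsec chords (length S) p q → Adj chords (lookup S p) (lookup S q)
    consec⇒adj p q p<q (inj₁ p+1≡q) = neighbours (∈-lookup p) (∈-lookup q) (lookup-< sorted p<q) none
      where
      none : NoneBetween S (lookup S p) (lookup S q)
      none m∈ p≺m m≺q = <⇒≱ r<q (subst (_≤ toℕ r) p+1≡q p<r)
        where
        r = index m∈
        p<r = lookup-reflects-< sorted (subst (lookup S p ≺_) (lookup-index m∈) p≺m)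
        r<q = lookup-reflects-< sorted (subst (_≺ lookup S q) (lookup-index m∈) m≺q)
    consec⇒adj p q p<q (inj₂ (p≡0 , q+1≡len)) = ends (∈-lookup p) (∈-lookup q) least greatest
      where
      least : Least S (lookup S p)
      least m∈ = subst (λ m → toℕ (lookup S p) ≤ toℕ m) (sym (lookup-index m∈))
                   (lookup-≤ sorted (subst (_≤ _) (sym p≡0) z≤n))
      greatest : Greatest S (lookup S q)
      greatest m∈ = subst (λ m → toℕ m ≤ toℕ (lookup S q)) (sym (lookup-index m∈))
                      (lookup-≤ sorted (m<1+n⇒m≤n (subst (toℕ (index m∈) <_) (sym q+1≡len) (toℕ<n (index m∈)))))

module Dissection {n : ℕ} (chords : List (Fin n × Fin n)) (outerplanar : IsOuterplanar chords) where
  open IsOuterplanar outerplanar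
  open StrictlySorted (toℕ {n})
  open FaceCriterion chords

  _≟ᵉ_ : DecidableEquality (Fin n × Fin n)
  _≟ᵉ_ = ≡-dec _≟ᶠ_ _≟ᶠ_

  open import Data.List.Membership.DecPropositional _≟ᵉ_ using (_∈?_)

  chord-< : ∀ {i j} → (i , j) ∈ chords → toℕ i < toℕ j
  chord-< c = proj₁ (All.lookup chord-edge c)

  chord-¬cycleEdge : ∀ {i j} → (i , j) ∈ chords → ¬ CycleEdge i j
  chord-¬cycleEdge c = proj₂ (All.lookup chord-edge c)

  chord-isEdge : ∀ {i j} → (i , j) ∈ chords → Edge chords i j
  chord-isEdge c = chord-< c , inj₂ c

  chord-suc< : ∀ {i j} → (i , j) ∈ chords → suc (toℕ i) < toℕ j
  chord-suc< c = ≤∧≢⇒< (chord-< c) (λ i+1≡j → chord-¬cycleEdge c (inj₁ (sym i+1≡j)))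

  uncrossed : ∀ {a b c d} → (a , b) ∈ chords → (c , d) ∈ chords →
              toℕ a < toℕ c → toℕ c < toℕ b → toℕ b < toℕ d → ⊥
  uncrossed ab cd a<c c<b b<d = noncrossing _ _ _ _ ab cd (a<c , c<b , b<d)

  -- (i , j) separates u from the edge PQ: it lies in the region [P, Q] and has u strictly between its ends.
  Hides : Fin n → Fin n → ℕ → Fin n × Fin n → Set
  Hides P Q u (i , j) = toℕ P ≤ toℕ i × toℕ i < u × u < toℕ j × toℕ j ≤ toℕ Q × (i , j) ≢ (P , Q)

  hides? : ∀ P Q u → Decidable (Hides P Q u)
  hides? P Q u (i , j) =
    (toℕ P ≤? toℕ i) ×-dec (toℕ i <? u) ×-dec (u <? toℕ j) ×-dec (toℕ j ≤? toℕ Q) ×-dec ¬? ((i , j) ≟ᵉ (P , Q))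

  Hidden : Fin n → Fin n → ℕ → Set
  Hidden P Q u = Any (Hides P Q u) chords

  Visible : Fin n → Fin n → Fin n → Set
  Visible P Q u = toℕ P ≤ toℕ u × toℕ u ≤ toℕ Q × ¬ Hidden P Q (toℕ u)

  visible? : ∀ P Q → Decidable (Visible P Q)
  visible? P Q u = (toℕ P ≤? toℕ u) ×-dec (toℕ u ≤? toℕ Q) ×-dec ¬? (any? (hides? P Q (toℕ u)) chords)

  -- For an edge PQ, the bounded face incident to PQ on the side of the vertices P, P+1, …, Q.
  faceBelow : Fin n → Fin n → List (Fin n)
  faceBelow P Q = filter (visible? P Q) (allFin n)

  ∈-faceBelow⁺ : ∀ {P Q u} → Visible P Q u → u ∈ faceBelow P Q
  ∈-faceBelow⁺ {P} {Q} {u} = ∈-filter⁺ (visible? P Q) (∈-allFin u)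

  ∈-faceBelow⁻ : ∀ {P Q u} → u ∈ faceBelow P Q → Visible P Q u
  ∈-faceBelow⁻ {P} {Q} = proj₂ ∘ ∈-filter⁻ (visible? P Q) {xs = allFin n}

  faceBelow-sorted : ∀ P Q → Linked _≺_ (faceBelow P Q)
  faceBelow-sorted P Q = filter⁺ (visible? P Q) <-trans (AllPairs⇒Linked (tabulate⁺-< id))

  lower-visible : ∀ {P Q} → toℕ P ≤ toℕ Q → Visible P Q P
  lower-visible P≤Q = ≤-refl , P≤Q , λ hidden → let _ , _ , P≤i , i<P , _ = find hidden in <⇒≱ i<P P≤i

  lower∈faceBelow : ∀ {P Q} → toℕ P ≤ toℕ Q → P ∈ faceBelow P Q
  lower∈faceBelow = ∈-faceBelow⁺ ∘ lower-visible

  upper∈faceBelow : ∀ {P Q} → toℕ P ≤ toℕ Q → Q ∈ faceBelow P Q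
  upper∈faceBelow P≤Q =
    ∈-faceBelow⁺ (P≤Q , ≤-refl , λ hidden → let _ , _ , _ , _ , Q<j , j≤Q , _ = find hidden in <⇒≱ Q<j j≤Q)

  fromℕ<∈faceBelow : ∀ {P Q u} (u<n : u < n) → toℕ P ≤ u → u ≤ toℕ Q → ¬ Hidden P Q u →
                     fromℕ< u<n ∈ faceBelow P Q
  fromℕ<∈faceBelow {P} {Q} u<n P≤u u≤Q unhidden = ∈-faceBelow⁺
    (subst (λ k → toℕ P ≤ k × k ≤ toℕ Q × ¬ Hidden P Q k) (sym (toℕ-fromℕ< u<n)) (P≤u , u≤Q , unhidden))

  hiding-chord-starts-at : ∀ {P Q s i j} → Visible P Q s → (i , j) ∈ chords → Hides P Q (suc (toℕ s)) (i , j) → i ≡ s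
  hiding-chord-starts-at (_ , _ , unhidden) ij∈ (P≤i , i<s+1 , s+1<j , j≤Q , ij≢PQ) with m≤n⇒m<n∨m≡n (≤-pred i<s+1)
  ... | inj₁ i<s = ⊥-elim (unhidden (lose ij∈ (P≤i , i<s , <-trans (n<1+n _) s+1<j , j≤Q , ij≢PQ)))
  ... | inj₂ i≡s = toℕ-injective i≡s

  ChordWithin : Fin n → Fin n → Fin n → Fin n → Set
  ChordWithin P Q s j = (s , j) ∈ chords × toℕ j ≤ toℕ Q × (s , j) ≢ (P , Q)

  chordWithin? : ∀ P Q s → Decidable (ChordWithin P Q s)
  chordWithin? P Q s j = ((s , j) ∈? chords) ×-dec (toℕ j ≤? toℕ Q) ×-dec ¬? ((s , j) ≟ᵉ (P , Q))

  longest-chord-from : ∀ {P Q s} → Visible P Q s → Hidden P Q (suc (toℕ s)) →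
                       Σ (Fin n) λ j → (s , j) ∈ chords × (s , j) ≢ (P , Q) × Visible P Q j
  longest-chord-from {P} {Q} {s} s-visible@(P≤s , _ , s-unhidden) s+1-hidden
    with (i , j₀) , ij₀∈ , hides@(_ , _ , _ , j₀≤Q , ij₀≢PQ) ← find s+1-hidden
    with refl ← hiding-chord-starts-at s-visible ij₀∈ hides
    with j , (longest , _) , maximal ← maximal-witness (chordWithin? P Q s) toℕ (ij₀∈ , j₀≤Q , ij₀≢PQ) (allFin n)
    = j , proj₁ longest , proj₂ (proj₂ longest) , (≤-trans P≤s (<⇒≤ s<j) , proj₁ (proj₂ longest) , j-unhidden)
    where
    s<j = chord-< (proj₁ longest)
    j-unhidden : ¬ Hidden P Q (toℕ j)
    j-unhidden hidden with (p , q) , pq∈ , (P≤p , p<j , j<q , q≤Q , pq≢PQ) ← find hidden | <-cmp (toℕ p) (toℕ s)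
    ... | tri< p<s _ _ = s-unhidden (lose pq∈ (P≤p , p<s , <-trans s<j j<q , q≤Q , pq≢PQ))
    ... | tri≈ _ p≡s _ with refl ← toℕ-injective p≡s = <⇒≱ j<q (maximal (∈-allFin q) (pq∈ , q≤Q , pq≢PQ))
    ... | tri> _ _ s<p = uncrossed (proj₁ longest) pq∈ s<p p<j j<q

  module _ {P Q : Fin n} where
    private F = faceBelow P Q

    neighbours-adjacent : ∀ {s t} → s ∈ F → t ∈ F → s ≺ t → NoneBetween F s t → Adj chords s t
    neighbours-adjacent {s} {t} s∈ t∈ s<t none with toℕ t ≟ suc (toℕ s)
    ... | yes t≡s+1 = inj₁ (s<t , inj₁ (inj₁ t≡s+1))
    ... | no  t≢s+1 with any? (hides? P Q (suc (toℕ s))) chords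
    ...   | no s+1-unhidden =
            ⊥-elim (none (fromℕ<∈faceBelow s+1<n (≤-trans P≤s (n≤1+n _)) (≤-trans (<⇒≤ s+1<t) t≤Q) s+1-unhidden)
                         (subst (toℕ s <_) (sym (toℕ-fromℕ< s+1<n)) (n<1+n _))
                         (subst (_< toℕ t) (sym (toℕ-fromℕ< s+1<n)) s+1<t))
      where
      P≤s = proj₁ (∈-faceBelow⁻ s∈)
      t≤Q = proj₁ (proj₂ (∈-faceBelow⁻ t∈))
      s+1<t = ≤∧≢⇒< s<t (t≢s+1 ∘ sym)
      s+1<n = <-trans s+1<t (toℕ<n t)
    ...   | yes s+1-hidden with j , sj∈ , sj≢PQ , j-visible ← longest-chord-from (∈-faceBelow⁻ s∈) s+1-hidden
                           with <-cmp (toℕ j) (toℕ t)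
    ...     | tri< j<t _ _ = ⊥-elim (none (∈-faceBelow⁺ j-visible) (chord-< sj∈) j<t)
    ...     | tri≈ _ j≡t _ = inj₁ (s<t , inj₂ (subst (λ t → (s , t) ∈ chords) (toℕ-injective j≡t) sj∈))
    ...     | tri> _ _ t<j = ⊥-elim (proj₂ (proj₂ (∈-faceBelow⁻ t∈))
                                      (lose sj∈ (proj₁ (∈-faceBelow⁻ s∈) , s<t , t<j , proj₁ (proj₂ j-visible) , sj≢PQ)))

    adjacent-across⇒ends : ∀ {s m t} → s ∈ F → m ∈ F → t ∈ F → s ≺ m → m ≺ t → Adj chords s t →
                           Least F s × Greatest F t
    adjacent-across⇒ends _ _ _ s<m m<t (inj₂ (t<s , _)) = ⊥-elim (<-asym t<s (<-trans s<m m<t))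
    adjacent-across⇒ends _ _ _ s<m m<t (inj₁ (_ , inj₁ (inj₁ t≡s+1))) =
      ⊥-elim (<⇒≱ s<m (≤-pred (subst (_ <_) t≡s+1 m<t)))
    adjacent-across⇒ends _ _ _ _ _ (inj₁ (_ , inj₁ (inj₂ (s≡0 , t+1≡n)))) =
      (λ _ → subst (_≤ _) (sym s≡0) z≤n) , (λ {m} _ → ≤-pred (subst (toℕ m <_) (sym t+1≡n) (toℕ<n m)))
    adjacent-across⇒ends {s} {m} {t} s∈ m∈ t∈ s<m m<t (inj₁ (_ , inj₂ st∈)) with (s , t) ≟ᵉ (P , Q)
    ... | yes refl = proj₁ ∘ ∈-faceBelow⁻ , proj₁ ∘ proj₂ ∘ ∈-faceBelow⁻
    ... | no st≢PQ = ⊥-elim (m-unhidden (lose st∈ (P≤s , s<m , m<t , t≤Q , st≢PQ)))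
      where
      P≤s = proj₁ (∈-faceBelow⁻ s∈)
      m-unhidden = proj₂ (proj₂ (∈-faceBelow⁻ m∈))
      t≤Q = proj₁ (proj₂ (∈-faceBelow⁻ t∈))

    ends-adjacent : Edge chords P Q → ∀ {s t} → s ∈ F → t ∈ F → Least F s → Greatest F t → Adj chords s t
    ends-adjacent PQ@(P<Q , _) s∈ t∈ least greatest
      with refl ← toℕ-injective (≤-antisym (least (lower∈faceBelow (<⇒≤ P<Q))) (proj₁ (∈-faceBelow⁻ s∈)))
         | refl ← toℕ-injective (≤-antisym (proj₁ (proj₂ (∈-faceBelow⁻ t∈))) (greatest (upper∈faceBelow (<⇒≤ P<Q))))
      = inj₁ PQ

    middle-vertex : suc (toℕ P) < toℕ Q → Σ (Fin n) λ m → m ∈ F × P ≺ m × m ≺ Q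
    middle-vertex P+1<Q with any? (hides? P Q (suc (toℕ P))) chords
    ... | no P+1-unhidden =
          fromℕ< P+1<n , fromℕ<∈faceBelow P+1<n (n≤1+n _) (<⇒≤ P+1<Q) P+1-unhidden ,
          subst (toℕ P <_) (sym (toℕ-fromℕ< P+1<n)) (n<1+n _) , subst (_< toℕ Q) (sym (toℕ-fromℕ< P+1<n)) P+1<Q
      where P+1<n = <-trans P+1<Q (toℕ<n Q)
    ... | yes P+1-hidden
      with j , Pj∈ , Pj≢PQ , j-visible ← longest-chord-from (lower-visible (<⇒≤ (<-trans (n<1+n _) P+1<Q))) P+1-hidden =
          j , ∈-faceBelow⁺ j-visible , chord-< Pj∈ ,
          ≤∧≢⇒< (proj₁ (proj₂ j-visible)) (λ j≡Q → Pj≢PQ (cong (P ,_) (toℕ-injective j≡Q)))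

    faceBelow-isBoundedFace : Edge chords P Q → suc (toℕ P) < toℕ Q → IsBoundedFace chords F
    faceBelow-isBoundedFace PQ P+1<Q with m , m∈ , P<m , m<Q ← middle-vertex P+1<Q =
      isBoundedFace-intro F sorted (3≤length sorted (lower∈faceBelow P≤Q) m∈ (upper∈faceBelow P≤Q) P<m m<Q)
        neighbours-adjacent (ends-adjacent PQ) adjacent-across⇒ends
      where
      sorted = faceBelow-sorted P Q
      P≤Q = <⇒≤ (proj₁ PQ)

  faceInside : ∀ {v w z} → (v , w) ∈ chords → toℕ z < toℕ v ⊎ toℕ w < toℕ z →
    Σ (List (Fin n)) λ F → IsBoundedFace chords F × v ∈ F × w ∈ F × z ∉ F
  faceInside vw∈ outside = faceBelow _ _ , faceBelow-isBoundedFace (chord-isEdge vw∈) (chord-suc< vw∈) ,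
                           lower∈faceBelow (<⇒≤ (chord-< vw∈)) , upper∈faceBelow (<⇒≤ (chord-< vw∈)) ,
                           λ z∈ → let v≤z , z≤w , _ = ∈-faceBelow⁻ z∈ in
                                  [ (λ z<v → <⇒≱ z<v v≤z) , (λ w<z → <⇒≱ w<z z≤w) ] outside

  Encloses : Fin n → Fin n → Fin n × Fin n → Set
  Encloses v w (P , Q) = toℕ P ≤ toℕ v × toℕ w ≤ toℕ Q × (P , Q) ≢ (v , w)

  encloses? : ∀ v w → Decidable (Encloses v w)
  encloses? v w (P , Q) = (toℕ P ≤? toℕ v) ×-dec (toℕ w ≤? toℕ Q) ×-dec ¬? ((P , Q) ≟ᵉ (v , w))

  width : Fin n × Fin n → ℕ
  width (P , Q) = toℕ Q ∸ toℕ P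

  width-< : ∀ {P Q i j} → toℕ P ≤ toℕ i → toℕ i ≤ toℕ j → toℕ j ≤ toℕ Q → (i , j) ≢ (P , Q) →
            width (i , j) < width (P , Q)
  width-< {P} P≤i i≤j j≤Q ij≢PQ with m≤n⇒m<n∨m≡n P≤i
  ... | inj₁ P<i = <-≤-trans (∸-monoʳ-< P<i i≤j) (∸-monoˡ-≤ (toℕ P) j≤Q)
  ... | inj₂ P≡i with refl ← toℕ-injective P≡i = ∸-monoˡ-< (≤∧≢⇒< j≤Q (ij≢PQ ∘ cong (P ,_) ∘ toℕ-injective)) i≤j

  private
    1≤n : 1 ≤ n
    1≤n = ≤-trans (s≤s z≤n) three≤n

  firstVertex lastVertex : Fin n
  firstVertex = fromℕ< 1≤n
  lastVertex  = fromℕ< (∸-monoʳ-< {n} {1} {0} z<s 1≤n)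

  boundary-isCycleEdge : CycleEdge firstVertex lastVertex
  boundary-isCycleEdge = inj₂ (toℕ-fromℕ< _ , trans (cong suc (toℕ-fromℕ< _)) (m+[n∸m]≡n 1≤n))

  boundary-isEdge : Edge chords firstVertex lastVertex
  boundary-isEdge = subst₂ _<_ (sym (toℕ-fromℕ< _)) (sym (toℕ-fromℕ< _)) (≤-trans (s≤s z≤n) (∸-monoˡ-≤ 1 three≤n)) ,
                    inj₁ boundary-isCycleEdge

  boundary-encloses : ∀ {v w} → (v , w) ∈ chords → Encloses v w (firstVertex , lastVertex)
  boundary-encloses {v} {w} vw∈ =
    subst (_≤ toℕ v) (sym (toℕ-fromℕ< _)) z≤n , subst (toℕ w ≤_) (sym (toℕ-fromℕ< _)) (∸-monoˡ-≤ 1 (toℕ<n w)) ,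
    λ boundary≡vw → chord-¬cycleEdge vw∈ (subst (λ e → CycleEdge (proj₁ e) (proj₂ e)) boundary≡vw boundary-isCycleEdge)

  -- The face on the far side of vw lies below the narrowest edge enclosing vw; the boundary
  -- edge (0, n-1) guarantees that such an edge exists.
  faceOutside : ∀ {v w z} → (v , w) ∈ chords → toℕ v < toℕ z → toℕ z < toℕ w →
    Σ (List (Fin n)) λ F → IsBoundedFace chords F × v ∈ F × w ∈ F × z ∉ F
  faceOutside {v} {w} vw∈ v<z z<w
    with (P , Q) , ((P≤v , w≤Q , PQ≢vw) , PQ-source) , tightest
           ← minimal-witness (encloses? v w) width (boundary-encloses vw∈) chords
    = faceBelow P Q , faceBelow-isBoundedFace PQ-edge P+1<Q ,
      ∈-faceBelow⁺ (P≤v , ≤-trans (<⇒≤ v<w) w≤Q , v-unhidden) ,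
      ∈-faceBelow⁺ (≤-trans P≤v (<⇒≤ v<w) , w≤Q , w-unhidden) ,
      λ z∈ → proj₂ (proj₂ (∈-faceBelow⁻ z∈)) (lose vw∈ (P≤v , v<z , z<w , w≤Q , PQ≢vw ∘ sym))
    where
    v<w = chord-< vw∈
    PQ-edge : Edge chords P Q
    PQ-edge = [ (λ PQ≡boundary → subst (λ e → Edge chords (proj₁ e) (proj₂ e)) (sym PQ≡boundary) boundary-isEdge)
              , chord-isEdge ] PQ-source
    P+1<Q = ≤-<-trans (s≤s P≤v) (<-≤-trans (chord-suc< vw∈) w≤Q)
    narrower : ∀ {i j} → (i , j) ∈ chords → Encloses v w (i , j) →
               toℕ P ≤ toℕ i → toℕ j ≤ toℕ Q → (i , j) ≢ (P , Q) → ⊥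
    narrower ij∈ encloses P≤i j≤Q ij≢PQ = <⇒≱ (width-< P≤i (<⇒≤ (chord-< ij∈)) j≤Q ij≢PQ) (tightest ij∈ encloses)
    v-unhidden : ¬ Hidden P Q (toℕ v)
    v-unhidden hidden with (i , j) , ij∈ , (P≤i , i<v , v<j , j≤Q , ij≢PQ) ← find hidden | <-cmp (toℕ j) (toℕ w)
    ... | tri< j<w _ _ = uncrossed ij∈ vw∈ i<v v<j j<w
    ... | tri≈ _ j≡w _ = narrower ij∈ (<⇒≤ i<v , ≤-reflexive (sym j≡w) , λ { refl → <-irrefl refl i<v }) P≤i j≤Q ij≢PQ
    ... | tri> _ _ w<j = narrower ij∈ (<⇒≤ i<v , <⇒≤ w<j , λ { refl → <-irrefl refl i<v }) P≤i j≤Q ij≢PQ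
    w-unhidden : ¬ Hidden P Q (toℕ w)
    w-unhidden hidden with (i , j) , ij∈ , (P≤i , i<w , w<j , j≤Q , ij≢PQ) ← find hidden | <-cmp (toℕ v) (toℕ i)
    ... | tri< v<i _ _ = uncrossed vw∈ ij∈ v<i i<w w<j
    ... | tri≈ _ v≡i _ = narrower ij∈ (≤-reflexive (sym v≡i) , <⇒≤ w<j , λ { refl → <-irrefl refl w<j }) P≤i j≤Q ij≢PQ
    ... | tri> _ _ i<v = narrower ij∈ (<⇒≤ i<v , <⇒≤ w<j , λ { refl → <-irrefl refl w<j }) P≤i j≤Q ij≢PQ

  faceAcross : ∀ {v w z} → (v , w) ∈ chords → z ≢ v → z ≢ w →
    Σ (List (Fin n)) λ F → IsBoundedFace chords F × v ∈ F × w ∈ F × z ∉ F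
  faceAcross {v} {w} {z} vw∈ z≢v z≢w with <-cmp (toℕ z) (toℕ v) | <-cmp (toℕ z) (toℕ w)
  ... | tri≈ _ z≡v _ | _ = ⊥-elim (z≢v (toℕ-injective z≡v))
  ... | _ | tri≈ _ z≡w _ = ⊥-elim (z≢w (toℕ-injective z≡w))
  ... | tri< z<v _ _ | _            = faceInside vw∈ (inj₁ z<v)
  ... | _            | tri> _ _ w<z = faceInside vw∈ (inj₂ w<z)
  ... | tri> _ _ v<z | tri< z<w _ _ = faceOutside vw∈ v<z z<w

module LinearExtension {n : ℕ} {chords : List (Fin n × Fin n)} (outerplanar : IsOuterplanar chords)
                       {L : Elem n → Elem n → Set} (linext : IsLinearExtension chords L) where
  open IsLinearExtension linext using (extends)
  open Dissection chords outerplanar using (faceAcross)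

  strictPartialOrder : StrictPartialOrder 0ℓ 0ℓ 0ℓ
  strictPartialOrder = record
    { isStrictPartialOrder = record
      { isEquivalence = isEquivalence
      ; irrefl        = λ { refl → IsLinearExtension.irrefl linext _ }
      ; trans         = IsLinearExtension.trans linext _ _ _
      ; <-resp-≈      = (λ {x} → subst (L x)) , (λ {x} → subst (λ y → L y x))
      }
    }

  open import Relation.Binary.Reasoning.StrictPartialOrder strictPartialOrder public

  critReversed⇒ends-below : ∀ {u T v w} → u ∈ T → u ≢ v → u ≢ w → Edge chords v w → CritReversed chords L u T v w →
                            L (vtx v) (vtx u) × L (vtx w) (vtx u)
  critReversed⇒ends-below {u} {T} {v} {w} _ _ _ vw@(_ , inj₁ cycle) (reversed , _) =
    (begin-strict vtx v <⟨ extends _ _ (vw , inj₁ refl) ⟩ edg v w <⟨ reversed cycle ⟩ vtx u ∎) ,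
    (begin-strict vtx w <⟨ extends _ _ (vw , inj₂ refl) ⟩ edg v w <⟨ reversed cycle ⟩ vtx u ∎)
  critReversed⇒ends-below {u} {T} {v} {w} u∈T u≢v u≢w (_ , inj₂ vw∈) (_ , reversed)
    with F , F-face , v∈F , w∈F , u∉F ← faceAcross vw∈ u≢v u≢w =
    (begin-strict vtx v <⟨ extends _ _ (F-face , v∈F) ⟩ fac F <⟨ F<u ⟩ vtx u ∎) ,
    (begin-strict vtx w <⟨ extends _ _ (F-face , w∈F) ⟩ fac F <⟨ F<u ⟩ vtx u ∎)
    where F<u = reversed vw∈ F F-face (λ { refl → u∉F u∈T }) v∈F w∈F

adj⇒edge : ∀ {n} {chords : List (Fin n × Fin n)} {x y} → toℕ x < toℕ y → Adj chords x y → Edge chords x y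
adj⇒edge _   (inj₁ xy)       = xy
adj⇒edge x<y (inj₂ (y<x , _)) = ⊥-elim (<-asym x<y y<x)

data Triangle {n : ℕ} (chords : List (Fin n × Fin n)) : List (Fin n) → Set where
  triangle : ∀ {t₀ t₁ t₂} → toℕ t₀ < toℕ t₁ → toℕ t₁ < toℕ t₂ →
             Edge chords t₀ t₁ → Edge chords t₁ t₂ → Edge chords t₀ t₂ → Triangle chords (t₀ ∷ t₁ ∷ t₂ ∷ [])

triangle-view : ∀ {n} {chords : List (Fin n × Fin n)} {T} → IsBoundedFace chords T → length T ≡ 3 →
                Triangle chords T
triangle-view {T = _ ∷ _ ∷ _ ∷ []} (t₀<t₁ ∷ t₁<t₂ ∷ [-] , _ , boundary) refl =
  triangle t₀<t₁ t₁<t₂ (adj⇒edge t₀<t₁ (proj₂ (boundary fzero (fsuc fzero) z<s) (inj₁ refl)))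
                       (adj⇒edge t₁<t₂ (proj₂ (boundary (fsuc fzero) (fsuc (fsuc fzero)) (s<s z<s)) (inj₁ refl)))
                       (adj⇒edge (<-trans t₀<t₁ t₁<t₂) (proj₂ (boundary fzero (fsuc (fsuc fzero)) z<s) (inj₂ (refl , refl))))

module AngleColouring {n : ℕ} {chords : List (Fin n × Fin n)} (outerplanar : IsOuterplanar chords)
                      {L : Fin 3 → Elem n → Elem n → Set} (realizer : IsRealizer chords L)
                      {col : Fin n → List (Fin n) → Fin 3} (colouring : IsAngleColoring chords L col) where

  module Order (m : Fin 3) = LinearExtension outerplanar (IsRealizer.linext realizer m)

  extends : ∀ {m x y} → _<P_ chords x y → L m x y
  extends {m} = IsLinearExtension.extends (IsRealizer.linext realizer m) _ _

  angle-dominates : ∀ {T u v} → IsBoundedFace chords T → length T ≡ 3 → u ∈ T → v ∈ T → u ≢ v →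
                    L (col u T) (vtx v) (vtx u)
  angle-dominates face size with triangle-view face size
  ... | triangle {t₀} {t₁} {t₂} t₀<t₁ t₁<t₂ e₀₁ e₁₂ e₀₂ = dominates
    where
    t₀<t₂ = <-trans t₀<t₁ t₁<t₂
    crit = colouring _ _ _ face
    below₀ = Order.critReversed⇒ends-below _ (here refl)
               (<⇒≢ᶠ t₀<t₁) (<⇒≢ᶠ t₀<t₂) e₁₂ (proj₁ crit)
    below₁ = Order.critReversed⇒ends-below _ (there (here refl))
               (<⇒≢ᶠ t₀<t₁ ∘ sym) (<⇒≢ᶠ t₁<t₂) e₀₂ (proj₁ (proj₂ crit))
    below₂ = Order.critReversed⇒ends-below _ (there (there (here refl)))
               (<⇒≢ᶠ t₀<t₂ ∘ sym) (<⇒≢ᶠ t₁<t₂ ∘ sym) e₀₁ (proj₂ (proj₂ crit))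
    T = t₀ ∷ t₁ ∷ t₂ ∷ []
    dominates : ∀ {u v} → u ∈ T → v ∈ T → u ≢ v → L (col u T) (vtx v) (vtx u)
    dominates (here refl)                 (here refl)                 u≢v = ⊥-elim (u≢v refl)
    dominates (here refl)                 (there (here refl))         _   = proj₁ below₀
    dominates (here refl)                 (there (there (here refl))) _   = proj₂ below₀
    dominates (there (here refl))         (here refl)                 _   = proj₁ below₁
    dominates (there (here refl))         (there (here refl))         u≢v = ⊥-elim (u≢v refl)
    dominates (there (here refl))         (there (there (here refl))) _   = proj₂ below₁
    dominates (there (there (here refl))) (here refl)                 _   = proj₁ below₂
    dominates (there (there (here refl))) (there (here refl))         _   = proj₂ below₂
    dominates (there (there (here refl))) (there (there (here refl))) u≢v = ⊥-elim (u≢v refl)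

  record ChordApex (T : List (Fin n)) (a b : Fin n) : Set where
    constructor apexAt
    field
      x        : Fin n
      x∈T      : x ∈ T
      x≢a      : x ≢ a
      x≢b      : x ≢ b
      reversed : CritReversed chords (L (col x T)) x T a b

  chord-apex : ∀ {T a b} → IsBoundedFace chords T → length T ≡ 3 → a ∈ T → b ∈ T → toℕ a < toℕ b →
               ChordApex T a b
  chord-apex face size with triangle-view face size
  ... | triangle {t₀} {t₁} {t₂} t₀<t₁ t₁<t₂ _ _ _ = apex
    where
    t₀<t₂ = <-trans t₀<t₁ t₁<t₂
    crit = colouring _ _ _ face
    T = t₀ ∷ t₁ ∷ t₂ ∷ []
    apex : ∀ {a b} → a ∈ T → b ∈ T → toℕ a < toℕ b → ChordApex T a b
    apex (here refl)         (there (here refl))         _ =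
      apexAt t₂ (there (there (here refl))) (<⇒≢ᶠ t₀<t₂ ∘ sym) (<⇒≢ᶠ t₁<t₂ ∘ sym) (proj₂ (proj₂ crit))
    apex (here refl)         (there (there (here refl))) _ =
      apexAt t₁ (there (here refl)) (<⇒≢ᶠ t₀<t₁ ∘ sym) (<⇒≢ᶠ t₁<t₂) (proj₁ (proj₂ crit))
    apex (there (here refl)) (there (there (here refl))) _ =
      apexAt t₀ (here refl) (<⇒≢ᶠ t₀<t₁) (<⇒≢ᶠ t₀<t₂) (proj₁ crit)
    apex (here refl)                 (here refl)                 a<b = ⊥-elim (<-irrefl refl a<b)
    apex (there (here refl))         (there (here refl))         a<b = ⊥-elim (<-irrefl refl a<b)
    apex (there (there (here refl))) (there (there (here refl))) a<b = ⊥-elim (<-irrefl refl a<b)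
    apex (there (here refl))         (here refl)                 a<b = ⊥-elim (<-asym a<b t₀<t₁)
    apex (there (there (here refl))) (here refl)                 a<b = ⊥-elim (<-asym a<b t₀<t₂)
    apex (there (there (here refl))) (there (here refl))         a<b = ⊥-elim (<-asym a<b t₁<t₂)

  open Dissection chords outerplanar using (chord-<; chord-isEdge; chord-¬cycleEdge)

  module ChordSide {a b : Fin n} (ab∈ : (a , b) ∈ chords) {T T′ : List (Fin n)}
                   (T-face : IsBoundedFace chords T) (T-size : length T ≡ 3) (T′-face : IsBoundedFace chords T′)
                   (T′≢T : T′ ≢ T) (a∈T : a ∈ T) (b∈T : b ∈ T) (a∈T′ : a ∈ T′) (b∈T′ : b ∈ T′) where

    open ChordApex (chord-apex T-face T-size a∈T b∈T (chord-< ab∈)) public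

    i : Fin 3
    i = col x T

    T′<x : L i (fac T′) (vtx x)
    T′<x = proj₂ reversed ab∈ T′ T′-face T′≢T a∈T′ b∈T′

    x<T : ∀ {m} → L m (vtx x) (fac T)
    x<T = extends (T-face , x∈T)

    apex-not-below-chord : ∀ {m} → L m (vtx x) (edg a b) → m ≢ i
    apex-not-below-chord x<ab refl =
      begin-contradiction vtx x   <⟨ x<ab ⟩
                          edg a b <⟨ extends (chord-isEdge ab∈ , T′-face , a∈T′ , b∈T′) ⟩
                          fac T′  <⟨ T′<x ⟩
                          vtx x   ∎
      where open Order i

    apex-below-F∞ : ∀ {m} → L m outer (edg a b) → L m (vtx x) (edg a b)
    apex-below-F∞ {m} F∞<ab = begin-strict vtx x <⟨ extends tt ⟩ outer <⟨ F∞<ab ⟩ edg a b ∎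
      where open Order m

    apex-below-endpoint-angle : ∀ {u} → u ≡ a ⊎ u ≡ b → L (col u T) (vtx x) (edg a b)
    apex-below-endpoint-angle (inj₁ refl) =
      begin-strict vtx x <⟨ angle-dominates T-face T-size a∈T x∈T (x≢a ∘ sym) ⟩
                   vtx a <⟨ extends (chord-isEdge ab∈ , inj₁ refl) ⟩ edg a b ∎
      where open Order (col a T)
    apex-below-endpoint-angle (inj₂ refl) =
      begin-strict vtx x <⟨ angle-dominates T-face T-size b∈T x∈T (x≢b ∘ sym) ⟩
                   vtx b <⟨ extends (chord-isEdge ab∈ , inj₂ refl) ⟩ edg a b ∎
      where open Order (col b T)

  module AroundChord {a b : Fin n} (ab∈ : (a , b) ∈ chords) {Tl Tr : List (Fin n)}
                     (Tl-face : IsBoundedFace chords Tl) (Tr-face : IsBoundedFace chords Tr)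
                     (Tl-size : length Tl ≡ 3) (Tr-size : length Tr ≡ 3) (Tl≢Tr : Tl ≢ Tr)
                     (a∈Tl : a ∈ Tl) (b∈Tl : b ∈ Tl) (a∈Tr : a ∈ Tr) (b∈Tr : b ∈ Tr) where

    module Left  = ChordSide ab∈ Tl-face Tl-size Tr-face (Tl≢Tr ∘ sym) a∈Tl b∈Tl a∈Tr b∈Tr
    module Right = ChordSide ab∈ Tr-face Tr-size Tl-face Tl≢Tr a∈Tr b∈Tr a∈Tl b∈Tl

    apex-colours-differ : Left.i ≢ Right.i
    apex-colours-differ i≡j =
      begin-contradiction vtx Left.x  <⟨ Left.x<T ⟩
                          fac Tl      <⟨ subst (λ m → L m (fac Tl) (vtx Right.x)) (sym i≡j) Right.T′<x ⟩
                          vtx Right.x <⟨ Right.x<T ⟩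
                          fac Tr      <⟨ Left.T′<x ⟩
                          vtx Left.x  ∎
      where open Order Left.i

    chord≰F∞ : ¬ _≤P_ chords (edg a b) outer
    chord≰F∞ (inj₂ (_ , cycle)) = chord-¬cycleEdge ab∈ cycle

    F∞-reversing-colour : Σ (Fin 3) λ k → L k outer (edg a b) × k ≢ Left.i × k ≢ Right.i
    F∞-reversing-colour
      with k , F∞<ab ← IsRealizer.realize realizer (edg a b) outer (chord-isEdge ab∈) tt chord≰F∞ =
      k , F∞<ab , Left.apex-not-below-chord (Left.apex-below-F∞ F∞<ab) ,
                  Right.apex-not-below-chord (Right.apex-below-F∞ F∞<ab)

    other-colours-reverse-F∞ : ∀ {c} → c ≢ Left.i → c ≢ Right.i → L c outer (edg a b)
    other-colours-reverse-F∞ c≢i c≢j with k , F∞<ab , k≢i , k≢j ← F∞-reversing-colour =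
      subst (λ m → L m outer (edg a b)) (≢-unique-Fin3 apex-colours-differ k≢i k≢j c≢i c≢j) F∞<ab

    doubled-colour-avoids-apices : ∀ {u c} → u ≡ a ⊎ u ≡ b → col u Tl ≡ c → col u Tr ≡ c →
                                   c ≢ Left.i × c ≢ Right.i
    doubled-colour-avoids-apices endpoint Tl-colour Tr-colour =
      Left.apex-not-below-chord
        (subst (λ m → L m (vtx Left.x) (edg a b)) Tl-colour (Left.apex-below-endpoint-angle endpoint)) ,
      Right.apex-not-below-chord
        (subst (λ m → L m (vtx Right.x) (edg a b)) Tr-colour (Right.apex-below-endpoint-angle endpoint))

lemma3p7 : {n : ℕ} (chords : List (Fin n × Fin n)) →
    IsMaximalPathLike chords →
    (L : Fin 3 → Elem n → Elem n → Set) → IsRealizer chords L →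
    (col : Fin n → List (Fin n) → Fin 3) → IsAngleColoring chords L col →
    (a b : Fin n) → (a , b) ∈ chords →
    (Tl Tr : List (Fin n)) → IsBoundedFace chords Tl → IsBoundedFace chords Tr → Tl ≢ Tr →
    a ∈ Tl → b ∈ Tl → a ∈ Tr → b ∈ Tr →
    (c : Fin 3) →
    ((col a Tl ≡ c) × (col a Tr ≡ c)) ⊎ ((col b Tl ≡ c) × (col b Tr ≡ c)) →
    L c outer (edg a b)
lemma3p7 chords mp L realizer col colouring a b ab∈ Tl Tr Tl-face Tr-face Tl≢Tr a∈Tl b∈Tl a∈Tr b∈Tr c doubled =
  uncurry other-colours-reverse-F∞ c-avoids-apices
  where
  open IsMaximalPathLike mp
  open AngleColouring outerplanar realizer {col} colouring
  open AroundChord ab∈ Tl-face Tr-face (maximal Tl Tl-face) (maximal Tr Tr-face) Tl≢Tr a∈Tl b∈Tl a∈Tr b∈Tr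
  c-avoids-apices : c ≢ Left.i × c ≢ Right.i
  c-avoids-apices = [_,_]′ (uncurry (doubled-colour-avoids-apices (inj₁ refl)))
                           (uncurry (doubled-colour-avoids-apices (inj₂ refl))) doubled
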